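{- Let $r\ge2$ be an integer, let $B_r=\sum_{n\ge0}b^{(r)}_nX^n\in\mathbb{F}_2[[X]]$, $C_r=B_r+1$, and let $P_r=\sum_{n\ge0}p^{(r)}_nX^n$ be the composition inverse of $C_r$ in $\mathbb{F}_2[[X]]$. Then $$p^{(r)}_n=\begin{cases}0 & \text{if } 2\mid n \text{ and } n<2^r,\\ 1&\text{otherwise.}\end{cases}$$
   Context: For an integer $r\ge2$, the sequence $(b^{(r)}_n)_{n\in\mathbb{N}}$ (values in $\mathbb{F}_2$) is defined by $b^{(r)}_0=1$ and, for $n\ge1$, $b^{(r)}_n=1$ if every maximal block of consecutive $0$'s in the binary expansion of $n$ has length divisible by $r$, and $b^{(r)}_n=0$ otherwise. The composition inverse of $U\in\mathbb{F}_2[[X]]$ with zero constant term and nonzero $X$-coefficient is the unique $V$ with $U(V(X))=V(U(X))=X$. -}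

module Defs where

open import Data.Nat using (ℕ; zero; suc; _+_; _∸_; _≡ᵇ_; _<ᵇ_)
open import Data.Nat.DivMod using (_%_; _/_)
open import Data.Nat.Divisibility using (_∣?_)
open import Data.Bool using (Bool; true; false; _∧_; _xor_; if_then_else_)
open import Data.List using (List; []; _∷_)
open import Data.Bool.ListAction using (all)
open import Relation.Nullary.Decidable using (⌊_⌋)
open import Relation.Binary.PropositionalEquality using (_≡_)
open import Data.Product using (_×_)

-- 𝔽₂ is modelled by Bool: addition = _xor_, multiplication = _∧_, 1 = true.
-- A formal power series over 𝔽₂ is its coefficient sequence.
Series : Set
Series = ℕ → Bool

-- Binary digits of n, least significant first, no leading zeros
-- (fuel-based; fuel n is always enough, see bits below).
bitsF : ℕ → ℕ → List Bool
bitsF zero    _ = []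
bitsF (suc f) zero = []
bitsF (suc f) (suc m) = ((suc m % 2) ≡ᵇ 1) ∷ bitsF f (suc m / 2)

bits : ℕ → List Bool
bits n = bitsF n n

-- Lengths of the maximal blocks of consecutive false's (0 digits).
zeroRunsAux : ℕ → List Bool → List ℕ
zeroRunsAux zero    []            = []
zeroRunsAux (suc a) []            = suc a ∷ []
zeroRunsAux a       (false ∷ bs)  = zeroRunsAux (suc a) bs
zeroRunsAux zero    (true ∷ bs)   = zeroRunsAux zero bs
zeroRunsAux (suc a) (true ∷ bs)   = suc a ∷ zeroRunsAux zero bs

zeroRuns : List Bool → List ℕ
zeroRuns = zeroRunsAux zero

b : ℕ → ℕ → Bool
b r zero    = true
b r (suc m) = all (λ l → ⌊ r ∣? l ⌋) (zeroRuns (bits (suc m)))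

B : ℕ → Series
B r = b r

C : ℕ → Series
C r zero    = b r zero xor true
C r (suc n) = b r (suc n)

sumTo : ℕ → (ℕ → Bool) → Bool
sumTo zero    f = f zero
sumTo (suc n) f = sumTo n f xor f (suc n)

oneS : Series
oneS zero    = true
oneS (suc _) = false

XS : Series
XS n = n ≡ᵇ 1

_*S_ : Series → Series → Series
(U *S V) n = sumTo n (λ i → U i ∧ V (n ∸ i))

powS : Series → ℕ → Series
powS U zero    = oneS
powS U (suc k) = U *S powS U k

-- Composition U(V(X)) (meaningful when V has zero constant term):
-- [X^n] U(V) = Σ_{k ≤ n} u_k [X^n] V^k.
compS : Series → Series → Series
compS U V n = sumTo n (λ k → U k ∧ powS V k n)

IsCompInverse : Series → Series → Set
IsCompInverse U V =
  (V zero ≡ false) × (V 1 ≡ true)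
  × (∀ n → compS U V n ≡ XS n) × (∀ n → compS V U n ≡ XS n)

module Submission where

-- Over 𝔽₂ the binary-digit
-- description of b^(r) yields the functional equation
--     C + C^(2^r) = X + X·C²:
-- appending a digit 0 to n doubles it, and by Frobenius (V^(2^k))_(2^k·n) = Vₙ,
-- so the even coefficients of C and of C^(2^r) agree (compare the trailing runs of
-- zeros of 2n and of n/2^(r-1)), while the right side has none; the odd coefficient
-- C_(2m+1) = [m = 0] + C_m of C is the odd coefficient of X + X·C², and
-- C^(2^r) has no odd coefficients.
-- Substituting P, which is a ring homomorphism with X ↦ P, and using C(P) = X gives
--     X + X^(2^r) = P + X²·P,
-- i.e. p₀ = 0, p₁ = 1 and p_(n+2) = p_n + [n + 2 = 2^r], which solves to the claim.

open import Defs
open import Data.Nat using (ℕ; _≤_; _<_; _^_)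
open import Data.Nat.Divisibility using (_∣_)
open import Data.Bool using (true; false)
open import Data.Product using (_×_)
open import Relation.Nullary using (¬_)
open import Relation.Binary.PropositionalEquality using (_≡_)

open import Algebra.Bundles using (CommutativeMonoid; CommutativeRing)
import Algebra.Properties.CommutativeSemigroup as CommSemigroupProperties
open import Data.Bool using (Bool; _∧_; _xor_)
open import Data.Bool.Properties
  using (∧-comm; ∧-assoc; ∧-zeroʳ; ∧-idem; ∧-distribˡ-xor; ∧-distribʳ-xor;
         xor-comm; xor-assoc; xor-same; xor-identityʳ; ∧-commutativeMonoid; xor-∧-commutativeRing)
open import Data.Bool.ListAction using (all)
open import Data.Empty using (⊥-elim)
open import Data.List using (_∷_; _++_; replicate)
open import Data.Nat using (zero; suc; _+_; _*_; _∸_; _≡ᵇ_; z≤n; s≤s; _≤?_; NonZero; >-nonZero⁻¹)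
open import Data.Nat.DivMod using (_%_; _/_; m/n<m; m*n%n≡0; m*n/n≡m; [m+kn]%n≡m%n; +-distrib-/)
open import Data.Nat.Divisibility
  using (_∣?_; divides; m∣m*n; _∣0; ∣⇒≤; ∣m∣n⇒∣m+n; ∣m+n∣m⇒∣n; ∣-refl)
open import Data.Nat.Properties
open import Data.Product using (_,_)
open import Data.Sum using (inj₁; inj₂)
open import Function.Base using (_∘_)
open import Function.Bundles using (_⇔_; mk⇔)
open import Relation.Nullary using (yes; no)
open import Relation.Nullary.Decidable using (⌊_⌋; isYes≗does; does-⇔; dec-true; dec-false)
open import Relation.Binary.PropositionalEquality
  using (_≢_; refl; sym; trans; cong; cong₂; subst; module ≡-Reasoning)

open CommSemigroupProperties (CommutativeMonoid.commutativeSemigroup ∧-commutativeMonoid)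
  using () renaming (interchange to ∧-interchange; x∙yz≈y∙xz to ∧-leftComm)
open CommSemigroupProperties
  (CommutativeMonoid.commutativeSemigroup (CommutativeRing.+-commutativeMonoid xor-∧-commutativeRing))
  using () renaming (interchange to xor-interchange)

xor-cancel-middle : ∀ a b d → (a xor b) xor (b xor d) ≡ a xor d
xor-cancel-middle a b d = begin
  (a xor b) xor (b xor d)  ≡⟨ xor-assoc a b (b xor d) ⟩
  a xor (b xor (b xor d))  ≡⟨ cong (a xor_) (sym (xor-assoc b b d)) ⟩
  a xor ((b xor b) xor d)  ≡⟨ cong (λ z → a xor (z xor d)) (xor-same b) ⟩
  a xor d                  ∎
  where open ≡-Reasoning

xor-solve : ∀ a b c → c ≡ a xor b → a ≡ b xor c
xor-solve a b c refl = trans (sym (xor-identityʳ a)) (trans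
  (cong (a xor_) (sym (xor-same b)))
  (trans (sym (xor-assoc a b b)) (xor-comm (a xor b) b)))

-- The indicator (m ≡ᵇ n) of the event m = n; the boolean part of ℕ's _≟_ is
-- computed by _≡ᵇ_, so the general facts about decisions apply.
≡ᵇ-true : ∀ {m n} → m ≡ n → (m ≡ᵇ n) ≡ true
≡ᵇ-true {m} {n} = dec-true (m ≟ n)

≡ᵇ-false : ∀ {m n} → m ≢ n → (m ≡ᵇ n) ≡ false
≡ᵇ-false {m} {n} = dec-false (m ≟ n)

∑≤ : ℕ → (ℕ → Bool) → Bool
∑≤ = sumTo

syntax ∑≤ n (λ i → f) = ∑[ i ≤ n ] f

sum-cong : ∀ n {f g : ℕ → Bool} → (∀ i → i ≤ n → f i ≡ g i) → ∑≤ n f ≡ ∑≤ n g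
sum-cong zero    f≗g = f≗g 0 z≤n
sum-cong (suc n) f≗g =
  cong₂ _xor_ (sum-cong n (λ i i≤n → f≗g i (m≤n⇒m≤1+n i≤n))) (f≗g (suc n) ≤-refl)

sum-xor : ∀ n (f g : ℕ → Bool) → ∑[ i ≤ n ] (f i xor g i) ≡ ∑≤ n f xor ∑≤ n g
sum-xor zero    f g = refl
sum-xor (suc n) f g = trans (cong (_xor (f (suc n) xor g (suc n))) (sum-xor n f g))
  (xor-interchange (∑≤ n f) (∑≤ n g) (f (suc n)) (g (suc n)))

sum-scaleˡ : ∀ n a (f : ℕ → Bool) → a ∧ ∑≤ n f ≡ ∑[ i ≤ n ] (a ∧ f i)
sum-scaleˡ zero    a f = refl
sum-scaleˡ (suc n) a f = trans (∧-distribˡ-xor a (∑≤ n f) (f (suc n)))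
  (cong (_xor (a ∧ f (suc n))) (sum-scaleˡ n a f))

sum-scaleʳ : ∀ n a (f : ℕ → Bool) → ∑≤ n f ∧ a ≡ ∑[ i ≤ n ] (f i ∧ a)
sum-scaleʳ zero    a f = refl
sum-scaleʳ (suc n) a f = trans (∧-distribʳ-xor a (∑≤ n f) (f (suc n)))
  (cong (_xor (f (suc n) ∧ a)) (sum-scaleʳ n a f))

sum-zero : ∀ n (f : ℕ → Bool) → (∀ i → i ≤ n → f i ≡ false) → ∑≤ n f ≡ false
sum-zero zero    f f≡0 = f≡0 0 z≤n
sum-zero (suc n) f f≡0
  rewrite sum-zero n f (λ i i≤n → f≡0 i (m≤n⇒m≤1+n i≤n)) = f≡0 (suc n) ≤-refl

sum-single : ∀ n (f : ℕ → Bool) m → m ≤ n → (∀ i → i ≤ n → i ≢ m → f i ≡ false) →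
  ∑≤ n f ≡ f m
sum-single zero    f zero z≤n _ = refl
sum-single (suc n) f m m≤1+n f≡0 with m≤n⇒m<n∨m≡n m≤1+n
... | inj₂ refl
  rewrite sum-zero n f (λ i i≤n → f≡0 i (m≤n⇒m≤1+n i≤n) (<⇒≢ (s≤s i≤n))) = refl
... | inj₁ (s≤s m≤n)
  rewrite sum-single n f m m≤n (λ i i≤n → f≡0 i (m≤n⇒m≤1+n i≤n))
        | f≡0 (suc n) ≤-refl (λ e → <⇒≢ (s≤s m≤n) (sym e)) = xor-identityʳ (f m)

sum-extend : ∀ {n} m (f : ℕ → Bool) → n ≤ m → (∀ i → n < i → i ≤ m → f i ≡ false) →
  ∑≤ m f ≡ ∑≤ n f
sum-extend zero    f z≤n   _   = refl
sum-extend (suc m) f n≤1+m f≡0 with m≤n⇒m<n∨m≡n n≤1+m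
... | inj₂ refl = refl
... | inj₁ (s≤s n≤m)
  rewrite sum-extend m f n≤m (λ i n<i i≤m → f≡0 i n<i (m≤n⇒m≤1+n i≤m))
        | f≡0 (suc m) (s≤s n≤m) ≤-refl = xor-identityʳ _

sum-swap : ∀ a c (f : ℕ → ℕ → Bool) →
  ∑[ i ≤ a ] ∑[ j ≤ c ] f i j ≡ ∑[ j ≤ c ] ∑[ i ≤ a ] f i j
sum-swap zero    c f = refl
sum-swap (suc a) c f = trans (cong (_xor ∑≤ c (f (suc a))) (sum-swap a c f))
  (sym (sum-xor c (λ j → ∑[ i ≤ a ] f i j) (f (suc a))))

sum-rotate₃ : ∀ n (f : ℕ → ℕ → ℕ → Bool) →
  ∑[ a ≤ n ] ∑[ b ≤ n ] ∑[ c ≤ n ] f a b c ≡ ∑[ b ≤ n ] ∑[ c ≤ n ] ∑[ a ≤ n ] f a b c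
sum-rotate₃ n f = trans (sum-swap n n (λ a b → ∑[ c ≤ n ] f a b c))
                        (sum-cong n (λ b _ → sum-swap n n (λ a c → f a b c)))

sum-rotate₄ : ∀ n (f : ℕ → ℕ → ℕ → ℕ → Bool) →
  ∑[ a ≤ n ] ∑[ b ≤ n ] ∑[ c ≤ n ] ∑[ d ≤ n ] f a b c d ≡
  ∑[ b ≤ n ] ∑[ c ≤ n ] ∑[ d ≤ n ] ∑[ a ≤ n ] f a b c d
sum-rotate₄ n f = trans (sum-swap n n (λ a b → ∑[ c ≤ n ] ∑[ d ≤ n ] f a b c d))
                        (sum-cong n (λ b _ → sum-rotate₃ n (λ a c d → f a b c d)))

sum²-scaleˡ : ∀ n a (f : ℕ → ℕ → Bool) →
  a ∧ ∑[ i ≤ n ] ∑[ j ≤ n ] f i j ≡ ∑[ i ≤ n ] ∑[ j ≤ n ] (a ∧ f i j)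
sum²-scaleˡ n a f = trans (sum-scaleˡ n a _) (sum-cong n (λ i _ → sum-scaleˡ n a (f i)))

sum²-scaleʳ : ∀ n a (f : ℕ → ℕ → Bool) →
  ∑[ i ≤ n ] ∑[ j ≤ n ] f i j ∧ a ≡ ∑[ i ≤ n ] ∑[ j ≤ n ] (f i j ∧ a)
sum²-scaleʳ n a f = trans (sum-scaleʳ n a _) (sum-cong n (λ i _ → sum-scaleʳ n a (f i)))

sum-product : ∀ a c (f g : ℕ → Bool) →
  ∑≤ a f ∧ ∑≤ c g ≡ ∑[ i ≤ a ] ∑[ j ≤ c ] (f i ∧ g j)
sum-product a c f g = trans (sum-scaleʳ a (∑≤ c g) f) (sum-cong a (λ i _ → sum-scaleˡ c (f i) g))

sum-collapse : ∀ n s (g : ℕ → Bool) x → (n < s → g s ≡ false) →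
  ∑[ a ≤ n ] (g a ∧ ((s ≡ᵇ a) ∧ x)) ≡ g s ∧ x
sum-collapse n s g x gs≡0 with s ≤? n
... | yes s≤n = trans (sum-single n _ s s≤n off-diagonal)
                      (cong (λ z → g s ∧ (z ∧ x)) (≡ᵇ-true {s} refl))
  where
  off-diagonal : ∀ i → i ≤ n → i ≢ s → g i ∧ ((s ≡ᵇ i) ∧ x) ≡ false
  off-diagonal i _ i≢s rewrite ≡ᵇ-false (λ e → i≢s (sym e)) = ∧-zeroʳ (g i)
... | no s≰n rewrite gs≡0 (≰⇒> s≰n) = sum-zero n _ out-of-range
  where
  out-of-range : ∀ i → i ≤ n → g i ∧ ((s ≡ᵇ i) ∧ x) ≡ false
  out-of-range i i≤n rewrite ≡ᵇ-false (λ e → s≰n (subst (_≤ n) (sym e) i≤n)) = ∧-zeroʳ (g i)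

sum-diagonal : ∀ n (f : ℕ → ℕ → Bool) → (∀ i j → f i j ≡ f j i) →
  ∑[ i ≤ n ] ∑[ j ≤ n ] f i j ≡ ∑[ i ≤ n ] f i i
sum-diagonal zero    f f-sym = refl
sum-diagonal (suc n) f f-sym = begin
  ∑[ i ≤ n ] (row i xor f i (suc n)) xor (row (suc n) xor corner)
    ≡⟨ cong (_xor (row (suc n) xor corner)) (sum-xor n row (λ i → f i (suc n))) ⟩
  (∑≤ n row xor ∑[ i ≤ n ] f i (suc n)) xor (row (suc n) xor corner)
    ≡⟨ cong (λ z → (∑≤ n row xor z) xor (row (suc n) xor corner))
            (sum-cong n (λ i _ → f-sym i (suc n))) ⟩
  (∑≤ n row xor row (suc n)) xor (row (suc n) xor corner)
    ≡⟨ xor-cancel-middle (∑≤ n row) (row (suc n)) corner ⟩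
  ∑≤ n row xor corner
    ≡⟨ cong (_xor corner) (sum-diagonal n f f-sym) ⟩
  ∑[ i ≤ n ] f i i xor corner ∎
  where
  open ≡-Reasoning
  row : ℕ → Bool
  row i = ∑≤ n (f i)
  corner : Bool
  corner = f (suc n) (suc n)

infix 4 _≈_
_≈_ : Series → Series → Set
U ≈ V = ∀ n → U n ≡ V n

infixl 6 _⊕_
_⊕_ : Series → Series → Series
(U ⊕ V) n = U n xor V n

-- The n-th coefficient of U·V as a sum over the square [0,N]² with the
-- indicator of i + j = n; unlike the defining triangle sum it is symmetric in
-- U and V and composes well, which gives commutativity and associativity.
box : ℕ → ℕ → Series → Series → Bool
box N n U V = ∑[ i ≤ N ] ∑[ j ≤ N ] (((i + j) ≡ᵇ n) ∧ (U i ∧ V j))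

*S-box : ∀ N n (U V : Series) → n ≤ N → (U *S V) n ≡ box N n U V
*S-box N n U V n≤N = sym (trans (sum-extend N _ n≤N (λ i n<i _ → row-above i n<i))
                                (sum-cong n (λ i i≤n → row-below i i≤n)))
  where
  row-below : ∀ i → i ≤ n → ∑[ j ≤ N ] (((i + j) ≡ᵇ n) ∧ (U i ∧ V j)) ≡ U i ∧ V (n ∸ i)
  row-below i i≤n =
    trans (sum-single N _ (n ∸ i) (≤-trans (m∸n≤m n i) n≤N) off)
          (cong (_∧ (U i ∧ V (n ∸ i))) (≡ᵇ-true (m+[n∸m]≡n i≤n)))
    where
    off : ∀ j → j ≤ N → j ≢ n ∸ i → ((i + j) ≡ᵇ n) ∧ (U i ∧ V j) ≡ false
    off j _ j≢n-i rewrite ≡ᵇ-false {i + j} {n}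
      (λ e → j≢n-i (trans (sym (m+n∸m≡n i j)) (cong (_∸ i) e))) = refl
  row-above : ∀ i → n < i → ∑[ j ≤ N ] (((i + j) ≡ᵇ n) ∧ (U i ∧ V j)) ≡ false
  row-above i n<i = sum-zero N _ off
    where
    off : ∀ j → j ≤ N → ((i + j) ≡ᵇ n) ∧ (U i ∧ V j) ≡ false
    off j _ rewrite ≡ᵇ-false {i + j} {n}
      (λ e → <⇒≱ n<i (subst (i ≤_) e (m≤m+n i j))) = refl

*S-cong : ∀ {U U′ V V′ : Series} → U ≈ U′ → V ≈ V′ → U *S V ≈ U′ *S V′
*S-cong U≈U′ V≈V′ n = sum-cong n (λ i _ → cong₂ _∧_ (U≈U′ i) (V≈V′ (n ∸ i)))

*S-comm : ∀ (U V : Series) → U *S V ≈ V *S U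
*S-comm U V n = begin
  (U *S V) n  ≡⟨ *S-box n n U V ≤-refl ⟩
  box n n U V ≡⟨ sum-swap n n _ ⟩
  ∑[ j ≤ n ] ∑[ i ≤ n ] (((i + j) ≡ᵇ n) ∧ (U i ∧ V j))
    ≡⟨ sum-cong n (λ j _ → sum-cong n (λ i _ →
         cong₂ _∧_ (cong (_≡ᵇ n) (+-comm i j)) (∧-comm (U i) (V j)))) ⟩
  box n n V U ≡⟨ *S-box n n V U ≤-refl ⟨
  (V *S U) n  ∎
  where open ≡-Reasoning

*S-assocˡ : ∀ (U V W : Series) n → ((U *S V) *S W) n ≡
  ∑[ i ≤ n ] ∑[ j ≤ n ] ∑[ k ≤ n ] ((((i + j) + k) ≡ᵇ n) ∧ ((U i ∧ V j) ∧ W k))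
*S-assocˡ U V W n = begin
  ((U *S V) *S W) n
    ≡⟨ *S-box n n (U *S V) W ≤-refl ⟩
  ∑[ a ≤ n ] ∑[ k ≤ n ] (((a + k) ≡ᵇ n) ∧ ((U *S V) a ∧ W k))
    ≡⟨ sum-cong n (λ a a≤n → sum-cong n (λ k _ →
         trans (cong (λ z → ((a + k) ≡ᵇ n) ∧ (z ∧ W k)) (*S-box n a U V a≤n))
               (trans (cong (((a + k) ≡ᵇ n) ∧_) (sum²-scaleʳ n (W k) _))
                      (sum²-scaleˡ n ((a + k) ≡ᵇ n) _)))) ⟩
  ∑[ a ≤ n ] ∑[ k ≤ n ] ∑[ i ≤ n ] ∑[ j ≤ n ]
    (((a + k) ≡ᵇ n) ∧ ((((i + j) ≡ᵇ a) ∧ (U i ∧ V j)) ∧ W k))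
    ≡⟨ sum-rotate₄ n _ ⟩
  ∑[ k ≤ n ] ∑[ i ≤ n ] ∑[ j ≤ n ] ∑[ a ≤ n ]
    (((a + k) ≡ᵇ n) ∧ ((((i + j) ≡ᵇ a) ∧ (U i ∧ V j)) ∧ W k))
    ≡⟨ sum-cong n (λ k _ → sum-cong n (λ i _ → sum-cong n (λ j _ →
         trans (sum-cong n (λ a _ → cong (((a + k) ≡ᵇ n) ∧_) (∧-assoc ((i + j) ≡ᵇ a) _ (W k))))
               (sum-collapse n (i + j) (λ a → (a + k) ≡ᵇ n) _
                 (λ n<i+j → ≡ᵇ-false (λ e → <⇒≱ n<i+j (subst (i + j ≤_) e (m≤m+n (i + j) k)))))))) ⟩
  ∑[ k ≤ n ] ∑[ i ≤ n ] ∑[ j ≤ n ] ((((i + j) + k) ≡ᵇ n) ∧ ((U i ∧ V j) ∧ W k))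
    ≡⟨ sum-rotate₃ n _ ⟩
  ∑[ i ≤ n ] ∑[ j ≤ n ] ∑[ k ≤ n ] ((((i + j) + k) ≡ᵇ n) ∧ ((U i ∧ V j) ∧ W k)) ∎
  where open ≡-Reasoning

*S-assocʳ : ∀ (U V W : Series) n → (U *S (V *S W)) n ≡
  ∑[ i ≤ n ] ∑[ j ≤ n ] ∑[ k ≤ n ] (((i + (j + k)) ≡ᵇ n) ∧ (U i ∧ (V j ∧ W k)))
*S-assocʳ U V W n = begin
  (U *S (V *S W)) n
    ≡⟨ *S-box n n U (V *S W) ≤-refl ⟩
  ∑[ i ≤ n ] ∑[ b ≤ n ] (((i + b) ≡ᵇ n) ∧ (U i ∧ (V *S W) b))
    ≡⟨ sum-cong n (λ i _ → sum-cong n (λ b b≤n →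
         trans (cong (λ z → ((i + b) ≡ᵇ n) ∧ (U i ∧ z)) (*S-box n b V W b≤n))
               (trans (cong (((i + b) ≡ᵇ n) ∧_) (sum²-scaleˡ n (U i) _))
                      (sum²-scaleˡ n ((i + b) ≡ᵇ n) _)))) ⟩
  ∑[ i ≤ n ] ∑[ b ≤ n ] ∑[ j ≤ n ] ∑[ k ≤ n ]
    (((i + b) ≡ᵇ n) ∧ (U i ∧ (((j + k) ≡ᵇ b) ∧ (V j ∧ W k))))
    ≡⟨ sum-cong n (λ i _ → sum-rotate₃ n _) ⟩
  ∑[ i ≤ n ] ∑[ j ≤ n ] ∑[ k ≤ n ] ∑[ b ≤ n ]
    (((i + b) ≡ᵇ n) ∧ (U i ∧ (((j + k) ≡ᵇ b) ∧ (V j ∧ W k))))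
    ≡⟨ sum-cong n (λ i _ → sum-cong n (λ j _ → sum-cong n (λ k _ →
         trans (sum-cong n (λ b _ → cong (((i + b) ≡ᵇ n) ∧_) (∧-leftComm (U i) ((j + k) ≡ᵇ b) _)))
               (sum-collapse n (j + k) (λ b → (i + b) ≡ᵇ n) _
                 (λ n<j+k → ≡ᵇ-false (λ e → <⇒≱ n<j+k (subst (j + k ≤_) e (m≤n+m (j + k) i)))))))) ⟩
  ∑[ i ≤ n ] ∑[ j ≤ n ] ∑[ k ≤ n ] (((i + (j + k)) ≡ᵇ n) ∧ (U i ∧ (V j ∧ W k))) ∎
  where open ≡-Reasoning

*S-assoc : ∀ (U V W : Series) → (U *S V) *S W ≈ U *S (V *S W)
*S-assoc U V W n = trans (*S-assocˡ U V W n) (trans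
  (sum-cong n (λ i _ → sum-cong n (λ j _ → sum-cong n (λ k _ →
     cong₂ _∧_ (cong (_≡ᵇ n) (+-assoc i j k)) (∧-assoc (U i) (V j) (W k))))))
  (sym (*S-assocʳ U V W n)))

*S-identityˡ : ∀ (V : Series) → oneS *S V ≈ V
*S-identityˡ V n = sum-single n _ 0 z≤n off
  where
  off : ∀ i → i ≤ n → i ≢ 0 → oneS i ∧ V (n ∸ i) ≡ false
  off zero    _ 0≢0 = ⊥-elim (0≢0 refl)
  off (suc i) _ _   = refl

*S-identityʳ : ∀ (V : Series) → V *S oneS ≈ V
*S-identityʳ V n = trans (*S-comm V oneS n) (*S-identityˡ V n)

X-shift : ∀ (U : Series) n → (XS *S U) (suc n) ≡ U n
X-shift U n = sum-single (suc n) _ 1 (s≤s z≤n) off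
  where
  off : ∀ i → i ≤ suc n → i ≢ 1 → XS i ∧ U (suc n ∸ i) ≡ false
  off i _ i≢1 rewrite ≡ᵇ-false i≢1 = refl

powS-cong : ∀ {U U′ : Series} → U ≈ U′ → ∀ k → powS U k ≈ powS U′ k
powS-cong U≈U′ zero    n = refl
powS-cong U≈U′ (suc k) = *S-cong U≈U′ (powS-cong U≈U′ k)

powS-+ : ∀ (W : Series) k l → powS W (k + l) ≈ powS W k *S powS W l
powS-+ W zero    l n = sym (*S-identityˡ (powS W l) n)
powS-+ W (suc k) l n = trans (*S-cong {W} (λ _ → refl) (powS-+ W k l) n)
                             (sym (*S-assoc W (powS W k) (powS W l) n))

powS-order : ∀ (W : Series) → W 0 ≡ false → ∀ k n → n < k → powS W k n ≡ false
powS-order W W₀ (suc k) zero    _ rewrite W₀ = refl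
powS-order W W₀ (suc k) (suc n) (s≤s n<k) = sum-zero (suc n) _ term
  where
  term : ∀ i → i ≤ suc n → W i ∧ powS W k (suc n ∸ i) ≡ false
  term zero    _ rewrite W₀ = refl
  term (suc i) _ rewrite powS-order W W₀ k (n ∸ i) (≤-<-trans (m∸n≤m n i) n<k) = ∧-zeroʳ (W (suc i))

powS-X : ∀ j n → powS XS j n ≡ (n ≡ᵇ j)
powS-X zero    zero    = refl
powS-X zero    (suc n) = refl
powS-X (suc j) zero    = refl
powS-X (suc j) (suc n) = trans (X-shift (powS XS j) n) (powS-X j n)

-- Frobenius: over 𝔽₂ squaring is V(X) ↦ V(X²), so (V²)₂ₘ = Vₘ and (V²)₂ₘ₊₁ = 0.

square-coeff : ∀ (V : Series) n → (V *S V) n ≡ ∑[ i ≤ n ] (((2 * i) ≡ᵇ n) ∧ V i)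
square-coeff V n = begin
  (V *S V) n   ≡⟨ *S-box n n V V ≤-refl ⟩
  box n n V V  ≡⟨ sum-diagonal n _ (λ i j → cong₂ _∧_ (cong (_≡ᵇ n) (+-comm i j)) (∧-comm (V i) (V j))) ⟩
  ∑[ i ≤ n ] (((i + i) ≡ᵇ n) ∧ (V i ∧ V i))
    ≡⟨ sum-cong n (λ i _ → cong₂ _∧_ (cong (_≡ᵇ n) (sym (two*-≡ i))) (∧-idem (V i))) ⟩
  ∑[ i ≤ n ] (((2 * i) ≡ᵇ n) ∧ V i) ∎
  where
  open ≡-Reasoning
  two*-≡ : ∀ i → 2 * i ≡ i + i
  two*-≡ i = cong (i +_) (+-identityʳ i)

frobenius-even : ∀ (V : Series) m → (V *S V) (2 * m) ≡ V m
frobenius-even V m = trans (square-coeff V (2 * m))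
  (trans (sum-single (2 * m) _ m (m≤n*m m 2) off)
         (cong (_∧ V m) (≡ᵇ-true {2 * m} refl)))
  where
  off : ∀ i → i ≤ 2 * m → i ≢ m → ((2 * i) ≡ᵇ (2 * m)) ∧ V i ≡ false
  off i _ i≢m rewrite ≡ᵇ-false (λ e → i≢m (*-cancelˡ-≡ i m 2 e)) = refl

frobenius-odd : ∀ (V : Series) m → (V *S V) (suc (2 * m)) ≡ false
frobenius-odd V m = trans (square-coeff V (suc (2 * m))) (sum-zero _ _ term)
  where
  term : ∀ i → i ≤ suc (2 * m) → ((2 * i) ≡ᵇ suc (2 * m)) ∧ V i ≡ false
  term i _ rewrite ≡ᵇ-false (even≢odd i m) = refl

-- Iterating Frobenius: V^(2^k) = V(X^(2^k)).

powS-2^suc : ∀ (V : Series) k → powS V (2 ^ suc k) ≈ powS V (2 ^ k) *S powS V (2 ^ k)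
powS-2^suc V k n =
  subst (λ e → powS V e n ≡ (powS V (2 ^ k) *S powS V (2 ^ k)) n)
        (cong (2 ^ k +_) (sym (+-identityʳ (2 ^ k))))
        (powS-+ V (2 ^ k) (2 ^ k) n)

powS-2^-even : ∀ (V : Series) k m → powS V (2 ^ suc k) (2 * m) ≡ powS V (2 ^ k) m
powS-2^-even V k m = trans (powS-2^suc V k (2 * m)) (frobenius-even (powS V (2 ^ k)) m)

powS-2^-odd : ∀ (V : Series) k m → powS V (2 ^ suc k) (suc (2 * m)) ≡ false
powS-2^-odd V k m = trans (powS-2^suc V k (suc (2 * m))) (frobenius-odd (powS V (2 ^ k)) m)

powS-2^-multiple : ∀ (V : Series) k q → powS V (2 ^ k) (2 ^ k * q) ≡ V q
powS-2^-multiple V zero    q rewrite *-identityˡ q = *S-identityʳ V q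
powS-2^-multiple V (suc k) q rewrite *-assoc 2 (2 ^ k) q =
  trans (powS-2^-even V k (2 ^ k * q)) (powS-2^-multiple V k q)

powS-2^-nonmultiple : ∀ (V : Series) i k p → i < k → powS V (2 ^ k) (2 ^ i * suc (2 * p)) ≡ false
powS-2^-nonmultiple V zero    (suc k) p _ rewrite *-identityˡ (suc (2 * p)) = powS-2^-odd V k p
powS-2^-nonmultiple V (suc i) (suc k) p (s≤s i<k) rewrite *-assoc 2 (2 ^ i) (suc (2 * p)) =
  trans (powS-2^-even V k (2 ^ i * suc (2 * p))) (powS-2^-nonmultiple V i k p i<k)

-- Substituting a series W without constant term, U ↦ U(W), is a ring homomorphism
-- 𝔽₂[[X]] → 𝔽₂[[X]] sending X to W.

module Substitution (W : Series) (W₀ : W 0 ≡ false) where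

  -- Since W^k starts at X^k, the defining sum may be extended to any N ≥ n.
  compS-extend : ∀ (U : Series) n N → n ≤ N → compS U W n ≡ ∑[ k ≤ N ] (U k ∧ powS W k n)
  compS-extend U n N n≤N = sym (sum-extend N _ n≤N (λ k n<k _ →
    trans (cong (U k ∧_) (powS-order W W₀ k n n<k)) (∧-zeroʳ (U k))))

  compS-cong : ∀ {U U′ : Series} → U ≈ U′ → compS U W ≈ compS U′ W
  compS-cong U≈U′ n = sum-cong n (λ k _ → cong (_∧ powS W k n) (U≈U′ k))

  compS-⊕ : ∀ (U V : Series) → compS (U ⊕ V) W ≈ compS U W ⊕ compS V W
  compS-⊕ U V n = trans (sum-cong n (λ k _ → ∧-distribʳ-xor (powS W k n) (U k) (V k)))
                        (sum-xor n _ _)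

  compS-one : compS oneS W ≈ oneS
  compS-one n = sum-single n _ 0 z≤n off
    where
    off : ∀ k → k ≤ n → k ≢ 0 → oneS k ∧ powS W k n ≡ false
    off zero    _ 0≢0 = ⊥-elim (0≢0 refl)
    off (suc k) _ _   = refl

  compS-X : compS XS W ≈ W
  compS-X zero    = sym W₀
  compS-X (suc n) = trans (sum-single (suc n) _ 1 (s≤s z≤n) off) (*S-identityʳ W (suc n))
    where
    off : ∀ k → k ≤ suc n → k ≢ 1 → XS k ∧ powS W k (suc n) ≡ false
    off k _ k≢1 rewrite ≡ᵇ-false k≢1 = refl

  -- Both sides of multiplicativity expand to ∑ₖ ∑ₗ uₖ vₗ [Xⁿ] W^(k+l).
  private
    expanded : Series → Series → ℕ → Bool
    expanded U V n = ∑[ k ≤ n ] ∑[ l ≤ n ] ((U k ∧ V l) ∧ powS W (k + l) n)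

  compS-*S-expand : ∀ (U V : Series) n → compS (U *S V) W n ≡ expanded U V n
  compS-*S-expand U V n = begin
    ∑[ m ≤ n ] ((U *S V) m ∧ powS W m n)
      ≡⟨ sum-cong n (λ m m≤n → trans (cong (_∧ powS W m n) (*S-box n m U V m≤n))
                                      (sum²-scaleʳ n (powS W m n) _)) ⟩
    ∑[ m ≤ n ] ∑[ k ≤ n ] ∑[ l ≤ n ] ((((k + l) ≡ᵇ m) ∧ (U k ∧ V l)) ∧ powS W m n)
      ≡⟨ sum-rotate₃ n _ ⟩
    ∑[ k ≤ n ] ∑[ l ≤ n ] ∑[ m ≤ n ] ((((k + l) ≡ᵇ m) ∧ (U k ∧ V l)) ∧ powS W m n)
      ≡⟨ sum-cong n (λ k _ → sum-cong n (λ l _ →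
           trans (sum-cong n (λ m _ → ∧-comm (((k + l) ≡ᵇ m) ∧ (U k ∧ V l)) (powS W m n)))
           (trans (sum-collapse n (k + l) (λ m → powS W m n) (U k ∧ V l) (powS-order W W₀ (k + l) n))
                  (∧-comm (powS W (k + l) n) (U k ∧ V l))))) ⟩
    expanded U V n ∎
    where open ≡-Reasoning

  *S-compS-expand : ∀ (U V : Series) n → (compS U W *S compS V W) n ≡ expanded U V n
  *S-compS-expand U V n = begin
    (compS U W *S compS V W) n
      ≡⟨ *S-box n n (compS U W) (compS V W) ≤-refl ⟩
    ∑[ a ≤ n ] ∑[ b ≤ n ] (((a + b) ≡ᵇ n) ∧ (compS U W a ∧ compS V W b))
      ≡⟨ sum-cong n (λ a a≤n → sum-cong n (λ b b≤n →
           trans (cong (((a + b) ≡ᵇ n) ∧_)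
                       (trans (cong₂ _∧_ (compS-extend U a n a≤n) (compS-extend V b n b≤n))
                              (sum-product n n _ _)))
                 (sum²-scaleˡ n ((a + b) ≡ᵇ n) _))) ⟩
    ∑[ a ≤ n ] ∑[ b ≤ n ] ∑[ k ≤ n ] ∑[ l ≤ n ] term a b k l
      ≡⟨ trans (sum-rotate₄ n _) (sum-rotate₄ n _) ⟩
    ∑[ k ≤ n ] ∑[ l ≤ n ] ∑[ a ≤ n ] ∑[ b ≤ n ] term a b k l
      ≡⟨ sum-cong n (λ k _ → sum-cong n (λ l _ →
           trans (sum-cong n (λ a _ → sum-cong n (λ b _ → regroup a b k l)))
           (trans (sym (sum²-scaleˡ n (U k ∧ V l) _))
                  (cong ((U k ∧ V l) ∧_) (trans (sym (*S-box n n (powS W k) (powS W l) ≤-refl))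
                                                (sym (powS-+ W k l n))))))) ⟩
    expanded U V n ∎
    where
    open ≡-Reasoning
    term : ℕ → ℕ → ℕ → ℕ → Bool
    term a b k l = ((a + b) ≡ᵇ n) ∧ ((U k ∧ powS W k a) ∧ (V l ∧ powS W l b))
    regroup : ∀ a b k l →
      term a b k l ≡ (U k ∧ V l) ∧ (((a + b) ≡ᵇ n) ∧ (powS W k a ∧ powS W l b))
    regroup a b k l =
      trans (cong (((a + b) ≡ᵇ n) ∧_) (∧-interchange (U k) (powS W k a) (V l) (powS W l b)))
            (∧-leftComm ((a + b) ≡ᵇ n) (U k ∧ V l) _)

  compS-*S : ∀ (U V : Series) → compS (U *S V) W ≈ compS U W *S compS V W
  compS-*S U V n = trans (compS-*S-expand U V n) (sym (*S-compS-expand U V n))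

  compS-powS : ∀ (U : Series) k → compS (powS U k) W ≈ powS (compS U W) k
  compS-powS U zero    = compS-one
  compS-powS U (suc k) n =
    trans (compS-*S U (powS U k) n) (*S-cong {compS U W} (λ _ → refl) (compS-powS U k) n)

data Parity : ℕ → Set where
  even : ∀ m → Parity (2 * m)
  odd  : ∀ m → Parity (suc (2 * m))

parity : ∀ n → Parity n
parity zero = even 0
parity (suc n) with parity n
... | even m = odd m
... | odd  m = subst Parity (*-suc 2 m) (even (suc m))

data TwoAdic : ℕ → Set where
  2^_·odd[_] : ∀ i p → TwoAdic (2 ^ i * suc (2 * p))

2^i·odd-nonZero : ∀ i p → NonZero (2 ^ i * suc (2 * p))
2^i·odd-nonZero i p = m*n≢0 (2 ^ i) (suc (2 * p)) {{m^n≢0 2 i}}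

twoAdic-double : ∀ {n} → TwoAdic n → TwoAdic (2 * n)
twoAdic-double 2^ i ·odd[ p ] = subst TwoAdic (*-assoc 2 (2 ^ i) (suc (2 * p))) 2^ suc i ·odd[ p ]

-- n + 1 is odd for even n; for n = 2m + 1 recurse on m, using the fuel f ≥ n.
twoAdic-bounded : ∀ f n → n ≤ f → TwoAdic (suc n)
twoAdic-bounded f n n≤f with parity n
... | even m = subst TwoAdic (*-identityˡ (suc (2 * m))) 2^ 0 ·odd[ m ]
twoAdic-bounded (suc f) _ (s≤s 2m≤f) | odd m =
  subst TwoAdic (*-suc 2 m) (twoAdic-double (twoAdic-bounded f m (≤-trans (m≤n*m m 2) 2m≤f)))

twoAdic : ∀ n → TwoAdic (suc n)
twoAdic n = twoAdic-bounded n n ≤-refl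

bitsF-fuel : ∀ f g n → n ≤ f → n ≤ g → bitsF f n ≡ bitsF g n
bitsF-fuel zero    zero    n       _       _       = refl
bitsF-fuel zero    (suc g) zero    _       _       = refl
bitsF-fuel (suc f) zero    zero    _       _       = refl
bitsF-fuel (suc f) (suc g) zero    _       _       = refl
bitsF-fuel (suc f) (suc g) (suc m) (s≤s m≤f) (s≤s m≤g) =
  cong (((suc m % 2) ≡ᵇ 1) ∷_)
       (bitsF-fuel f g (suc m / 2) (≤-trans half≤m m≤f) (≤-trans half≤m m≤g))
  where
  half≤m : suc m / 2 ≤ m
  half≤m = ≤-pred (m/n<m (suc m) 2 (s≤s (s≤s z≤n)))

bits-suc : ∀ m → bits (suc m) ≡ ((suc m % 2) ≡ᵇ 1) ∷ bits (suc m / 2)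
bits-suc m = cong (((suc m % 2) ≡ᵇ 1) ∷_) (bitsF-fuel m (suc m / 2) (suc m / 2) half≤m ≤-refl)
  where
  half≤m : suc m / 2 ≤ m
  half≤m = ≤-pred (m/n<m (suc m) 2 (s≤s (s≤s z≤n)))

bits-double : ∀ n .{{_ : NonZero n}} → bits (2 * n) ≡ false ∷ bits n
bits-double (suc m) = trans (bits-suc (m + suc (m + 0)))
  (cong₂ _∷_ (cong (_≡ᵇ 1) last-digit) (cong bits half))
  where
  last-digit : (2 * suc m) % 2 ≡ 0
  last-digit = trans (cong (_% 2) (*-comm 2 (suc m))) (m*n%n≡0 (suc m) 2)
  half : (2 * suc m) / 2 ≡ suc m
  half = trans (cong (_/ 2) (*-comm 2 (suc m))) (m*n/n≡m (suc m) 2)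

bits-odd : ∀ p → bits (suc (2 * p)) ≡ true ∷ bits p
bits-odd p = trans (bits-suc (2 * p)) (cong₂ _∷_ (cong (_≡ᵇ 1) last-digit) (cong bits half))
  where
  as-sum : suc (2 * p) ≡ 1 + p * 2
  as-sum = cong suc (*-comm 2 p)
  last-digit : suc (2 * p) % 2 ≡ 1
  last-digit = trans (cong (_% 2) as-sum) ([m+kn]%n≡m%n 1 p 2)
  half : suc (2 * p) / 2 ≡ p
  half = trans (cong (_/ 2) as-sum)
               (trans (+-distrib-/ 1 (p * 2) no-carry) (m*n/n≡m p 2))
    where
    no-carry : 1 % 2 + (p * 2) % 2 < 2
    no-carry = subst (λ z → 1 % 2 + z < 2) (sym (m*n%n≡0 p 2)) (s≤s (s≤s z≤n))

bits-2adic : ∀ j p → bits (2 ^ j * suc (2 * p)) ≡ replicate j false ++ (true ∷ bits p)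
bits-2adic zero    p = trans (cong bits (*-identityˡ (suc (2 * p)))) (bits-odd p)
bits-2adic (suc j) p rewrite *-assoc 2 (2 ^ j) (suc (2 * p)) =
  trans (bits-double (2 ^ j * suc (2 * p)) {{2^i·odd-nonZero j p}})
        (cong (false ∷_) (bits-2adic j p))

zeroRunsAux-replicate : ∀ a j bs → zeroRunsAux a (replicate j false ++ bs) ≡ zeroRunsAux (a + j) bs
zeroRunsAux-replicate a       zero    bs rewrite +-identityʳ a = refl
zeroRunsAux-replicate zero    (suc j) bs = zeroRunsAux-replicate 1 j bs
zeroRunsAux-replicate (suc a) (suc j) bs rewrite +-suc a j = zeroRunsAux-replicate (suc (suc a)) j bs

-- b^(r)_n without the special case n = 0 (both give 1 there).
runsDivisible : ℕ → ℕ → Bool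
runsDivisible r n = all (λ l → ⌊ r ∣? l ⌋) (zeroRuns (bits n))

C-positive : ∀ r n .{{_ : NonZero n}} → C r n ≡ runsDivisible r n
C-positive r (suc n) = refl

-- b^(r)_(2n+1) = b^(r)_n: a final digit 1 adds no zero run.
runsDivisible-odd : ∀ r p → runsDivisible r (suc (2 * p)) ≡ runsDivisible r p
runsDivisible-odd r p rewrite bits-odd p = refl

-- b^(r) at 2^j·(2p+1): the trailing run of j zeros must have length divisible by r.
runsDivisible-2adic : ∀ r j p → runsDivisible r (2 ^ j * suc (2 * p)) ≡ ⌊ r ∣? j ⌋ ∧ runsDivisible r p
runsDivisible-2adic r j p
  rewrite bits-2adic j p | zeroRunsAux-replicate 0 j (true ∷ bits p) with j
... | zero   = cong (_∧ runsDivisible r p) (sym (trans (isYes≗does (r ∣? 0)) (dec-true (r ∣? 0) (r ∣0))))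
... | suc _  = refl

-- The functional equation C + C^(2^r) = X + X·C² for C = C_r with r = k + 1 ≥ 1.

divides-test-cong : ∀ {r a c} → (r ∣ a ⇔ r ∣ c) → ⌊ r ∣? a ⌋ ≡ ⌊ r ∣? c ⌋
divides-test-cong {r} {a} {c} a⇔c = trans (isYes≗does (r ∣? a))
  (trans (does-⇔ a⇔c (r ∣? a) (r ∣? c)) (sym (isYes≗does (r ∣? c))))

module FunctionalEquation (k : ℕ) where

  private
    r : ℕ
    r = suc k

  -- [X^n] C^(2^k) at n = 2^i(2p+1) equals b^(r) at 2n = 2^(i+1)(2p+1).
  powS-C-2adic : ∀ i p → powS (C r) (2 ^ k) (2 ^ i * suc (2 * p)) ≡ ⌊ r ∣? suc i ⌋ ∧ runsDivisible r p
  powS-C-2adic i p with k ≤? i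
  ... | no k≰i = trans (powS-2^-nonmultiple (C r) i k p (≰⇒> k≰i))
                       (cong (_∧ runsDivisible r p) (sym short-run))
    where
    short-run : ⌊ r ∣? suc i ⌋ ≡ false
    short-run = trans (isYes≗does (r ∣? suc i))
                      (dec-false (r ∣? suc i) (λ r∣1+i → <⇒≱ (s≤s (≰⇒> k≰i)) (∣⇒≤ r∣1+i)))
  ... | yes k≤i with m≤n⇒∃[o]m+o≡n k≤i
  ...   | d , refl = begin
    powS (C r) (2 ^ k) (2 ^ (k + d) * suc (2 * p))
      ≡⟨ cong (powS (C r) (2 ^ k)) regroup ⟩
    powS (C r) (2 ^ k) (2 ^ k * (2 ^ d * suc (2 * p)))
      ≡⟨ powS-2^-multiple (C r) k _ ⟩
    C r (2 ^ d * suc (2 * p))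
      ≡⟨ C-positive r _ {{2^i·odd-nonZero d p}} ⟩
    runsDivisible r (2 ^ d * suc (2 * p))
      ≡⟨ runsDivisible-2adic r d p ⟩
    ⌊ r ∣? d ⌋ ∧ runsDivisible r p
      ≡⟨ cong (_∧ runsDivisible r p)
              (divides-test-cong (mk⇔ (∣m∣n⇒∣m+n ∣-refl) (λ r∣r+d → ∣m+n∣m⇒∣n r∣r+d ∣-refl))) ⟩
    ⌊ r ∣? r + d ⌋ ∧ runsDivisible r p ∎
    where
    open ≡-Reasoning
    regroup : 2 ^ (k + d) * suc (2 * p) ≡ 2 ^ k * (2 ^ d * suc (2 * p))
    regroup = trans (cong (_* suc (2 * p)) (^-distribˡ-+-* 2 k d)) (*-assoc (2 ^ k) (2 ^ d) _)

  C-even : ∀ {n} → TwoAdic n → C r (2 * n) ≡ powS (C r) (2 ^ k) n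
  C-even 2^ i ·odd[ p ] = begin
    C r (2 * (2 ^ i * suc (2 * p)))
      ≡⟨ cong (C r) (sym (*-assoc 2 (2 ^ i) (suc (2 * p)))) ⟩
    C r (2 ^ suc i * suc (2 * p))
      ≡⟨ C-positive r _ {{2^i·odd-nonZero (suc i) p}} ⟩
    runsDivisible r (2 ^ suc i * suc (2 * p))
      ≡⟨ runsDivisible-2adic r (suc i) p ⟩
    ⌊ r ∣? suc i ⌋ ∧ runsDivisible r p
      ≡⟨ powS-C-2adic i p ⟨
    powS (C r) (2 ^ k) (2 ^ i * suc (2 * p)) ∎
    where open ≡-Reasoning

  C-odd : ∀ m → C r (suc (2 * m)) ≡ XS (suc (2 * m)) xor C r m
  C-odd zero    = refl
  C-odd (suc m) = runsDivisible-odd r (suc m)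

  functional-equation : C r ⊕ powS (C r) (2 ^ r) ≈ XS ⊕ XS *S (C r *S C r)
  functional-equation n with parity n
  ... | even zero    = cong (false xor_) (powS-order (C r) refl (2 ^ r) 0 (m^n>0 2 r))
  ... | even (suc m) = begin
    C r (2 * suc m) xor powS (C r) (2 ^ r) (2 * suc m)
      ≡⟨ cong (C r (2 * suc m) xor_) (powS-2^-even (C r) k (suc m)) ⟩
    C r (2 * suc m) xor powS (C r) (2 ^ k) (suc m)
      ≡⟨ cong (_xor powS (C r) (2 ^ k) (suc m)) (C-even (twoAdic m)) ⟩
    powS (C r) (2 ^ k) (suc m) xor powS (C r) (2 ^ k) (suc m)
      ≡⟨ xor-same (powS (C r) (2 ^ k) (suc m)) ⟩
    false
      ≡⟨ cong₂ _xor_ (≡ᵇ-false (even≢odd (suc m) 0)) shifted-square ⟨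
    XS (2 * suc m) xor (XS *S (C r *S C r)) (2 * suc m) ∎
    where
    open ≡-Reasoning
    shifted-square : (XS *S (C r *S C r)) (2 * suc m) ≡ false
    shifted-square = trans (cong (XS *S (C r *S C r)) (*-suc 2 m))
                           (trans (X-shift (C r *S C r) (suc (2 * m))) (frobenius-odd (C r) m))
  ... | odd m = begin
    C r (suc (2 * m)) xor powS (C r) (2 ^ r) (suc (2 * m))
      ≡⟨ cong (C r (suc (2 * m)) xor_) (powS-2^-odd (C r) k m) ⟩
    C r (suc (2 * m)) xor false
      ≡⟨ xor-identityʳ _ ⟩
    C r (suc (2 * m))
      ≡⟨ C-odd m ⟩
    XS (suc (2 * m)) xor C r m
      ≡⟨ cong (XS (suc (2 * m)) xor_) (trans (X-shift (C r *S C r) (2 * m)) (frobenius-even (C r) m)) ⟨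
    XS (suc (2 * m)) xor (XS *S (C r *S C r)) (suc (2 * m)) ∎
    where open ≡-Reasoning

-- Substituting the inverse P: C(P) = X turns the functional equation into
-- X + X^(2^r) = P + X²·P, i.e. a two-step recurrence for the coefficients of P.

module InverseRecurrence (k : ℕ) (P : Series) (P₀ : P 0 ≡ false)
                         (C∘P≡X : compS (C (suc k)) P ≈ XS) where

  open Substitution P P₀
  open FunctionalEquation k

  private
    r : ℕ
    r = suc k

  C²∘P≡X² : compS (C r *S C r) P ≈ XS *S XS
  C²∘P≡X² n = trans (compS-*S (C r) (C r) n) (*S-cong C∘P≡X C∘P≡X n)

  inverse-equation : ∀ n → XS n xor (n ≡ᵇ 2 ^ r) ≡ P n xor (XS *S (XS *S P)) n
  inverse-equation n = begin
    XS n xor (n ≡ᵇ 2 ^ r)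
      ≡⟨ cong₂ _xor_ (C∘P≡X n) (trans (compS-powS (C r) (2 ^ r) n)
                                      (trans (powS-cong C∘P≡X (2 ^ r) n) (powS-X (2 ^ r) n))) ⟨
    compS (C r) P n xor compS (powS (C r) (2 ^ r)) P n
      ≡⟨ compS-⊕ (C r) (powS (C r) (2 ^ r)) n ⟨
    compS (C r ⊕ powS (C r) (2 ^ r)) P n
      ≡⟨ compS-cong functional-equation n ⟩
    compS (XS ⊕ XS *S (C r *S C r)) P n
      ≡⟨ compS-⊕ XS (XS *S (C r *S C r)) n ⟩
    compS XS P n xor compS (XS *S (C r *S C r)) P n
      ≡⟨ cong₂ _xor_ (compS-X n)
               (trans (compS-*S XS (C r *S C r) n) (*S-cong compS-X C²∘P≡X² n)) ⟩
    P n xor (P *S (XS *S XS)) n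
      ≡⟨ cong (P n xor_) (trans (*S-comm P (XS *S XS) n) (*S-assoc XS XS P n)) ⟩
    P n xor (XS *S (XS *S P)) n ∎
    where open ≡-Reasoning

  -- The coefficient of X¹ (also part of IsCompInverse, but it follows).
  P-one : P 1 ≡ true
  P-one = begin
    P 1                          ≡⟨ xor-identityʳ (P 1) ⟨
    P 1 xor false                ≡⟨ cong (P 1 xor_) (X-shift (XS *S P) 0) ⟨
    P 1 xor (XS *S (XS *S P)) 1  ≡⟨ inverse-equation 1 ⟨
    true xor (1 ≡ᵇ 2 ^ r)        ≡⟨ cong (true xor_) (≡ᵇ-false (λ 1≡2^r → even≢odd (2 ^ k) 0 (sym 1≡2^r))) ⟩
    true                         ∎
    where open ≡-Reasoning

  P-step : ∀ n → P (2 + n) ≡ P n xor ((2 + n) ≡ᵇ 2 ^ r)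
  P-step n = xor-solve (P (2 + n)) (P n) _
    (trans (inverse-equation (2 + n))
           (cong (P (2 + n) xor_) (trans (X-shift (XS *S P) (suc n)) (X-shift P n))))

-- Solving the recurrence p₀ = 0, p₁ = 1, p_(n+2) = p_n + [n + 2 = 2K].

double-≡ᵇ : ∀ a b → (2 * a ≡ᵇ 2 * b) ≡ (a ≡ᵇ b)
double-≡ᵇ a b = does-⇔ (mk⇔ (*-cancelˡ-≡ a b 2) (cong (2 *_))) (2 * a ≟ 2 * b) (a ≟ b)

module TwoStepRecurrence (K : ℕ) .{{_ : NonZero K}} (p : ℕ → Bool)
                         (p₀ : p 0 ≡ false) (p₁ : p 1 ≡ true)
                         (p-step : ∀ n → p (2 + n) ≡ p n xor ((2 + n) ≡ᵇ 2 * K)) where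

  p-odd : ∀ m → p (suc (2 * m)) ≡ true
  p-odd zero    = p₁
  p-odd (suc m) = begin
    p (suc (2 * suc m))                               ≡⟨ cong (p ∘ suc) (*-suc 2 m) ⟩
    p (2 + suc (2 * m))                               ≡⟨ p-step (suc (2 * m)) ⟩
    p (suc (2 * m)) xor ((2 + suc (2 * m)) ≡ᵇ 2 * K)  ≡⟨ cong₂ _xor_ (p-odd m) (≡ᵇ-false odd≢2K) ⟩
    true                                              ∎
    where
    open ≡-Reasoning
    odd≢2K : 2 + suc (2 * m) ≢ 2 * K
    odd≢2K e = even≢odd K (suc m) (trans (sym e) (cong suc (sym (*-suc 2 m))))

  p-even-step : ∀ m → p (2 * suc m) ≡ p (2 * m) xor (suc m ≡ᵇ K)
  p-even-step m = trans (cong p (*-suc 2 m))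
    (trans (p-step (2 * m)) (cong (p (2 * m) xor_)
      (trans (cong (_≡ᵇ 2 * K) (sym (*-suc 2 m))) (double-≡ᵇ (suc m) K))))

  p-even-below : ∀ m → m < K → p (2 * m) ≡ false
  p-even-below zero    _     = p₀
  p-even-below (suc m) 1+m<K = trans (p-even-step m)
    (cong₂ _xor_ (p-even-below m (<-trans (n<1+n m) 1+m<K)) (≡ᵇ-false (<⇒≢ 1+m<K)))

  p-even-above : ∀ m → K ≤ m → p (2 * m) ≡ true
  p-even-above zero    K≤0   = ⊥-elim (<⇒≱ (>-nonZero⁻¹ K) K≤0)
  p-even-above (suc m) K≤1+m with m≤n⇒m<n∨m≡n K≤1+m
  ... | inj₁ (s≤s K≤m) = trans (p-even-step m)
    (cong₂ _xor_ (p-even-above m K≤m) (≡ᵇ-false (λ e → <⇒≢ (s≤s K≤m) (sym e))))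
  ... | inj₂ refl = trans (p-even-step m)
    (cong₂ _xor_ (p-even-below m ≤-refl) (≡ᵇ-true {suc m} refl))

  p-classify : ∀ n → ((2 ∣ n × n < 2 * K) → p n ≡ false) × (¬ (2 ∣ n × n < 2 * K) → p n ≡ true)
  p-classify n with parity n
  ... | even m = (λ (_ , 2m<2K) → p-even-below m (*-cancelˡ-< 2 m K 2m<2K))
               , (λ ¬low → p-even-above m (≮⇒≥ (λ m<K → ¬low (m∣m*n m , *-monoʳ-< 2 m<K))))
  ... | odd m  = (λ (2∣odd , _) → ⊥-elim (not-even 2∣odd)) , (λ _ → p-odd m)
    where
    not-even : ¬ (2 ∣ suc (2 * m))
    not-even (divides q eq) = even≢odd q m (sym (trans eq (*-comm q 2)))

-- The theorem; r ≥ 1 would suffice. With r = k + 1 we have 2^r = 2·2^k.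
mainTheorem17 : (r : ℕ) → 2 ≤ r → (P : Series) → IsCompInverse (C r) P →
    (n : ℕ) →
    ((2 ∣ n × n < 2 ^ r) → P n ≡ false)
    × (¬ (2 ∣ n × n < 2 ^ r) → P n ≡ true)
mainTheorem17 zero    ()
mainTheorem17 (suc k) _ P (P₀ , _ , C∘P≡X , _) = p-classify
  where
  open InverseRecurrence k P P₀ C∘P≡X using (P-one; P-step)
  open TwoStepRecurrence (2 ^ k) {{m^n≢0 2 k}} P P₀ P-one P-step using (p-classify)
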